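{- Let $R$ be a commutative domain with unity, and let $f\in R[t]$ be a polynomial of degree $d\ge 2$. Then $f$ is not weakly $k$-superirreducible over $R$ for any integer $k\ge d$.
   Context: Let $R$ be a commutative domain with unity with field of fractions $F$. A polynomial $f\in R[t]$ is weakly $k$-superirreducible over $R$ (for a natural number $k$) if $f(g(t))$ is irreducible in $F[t]$ for every polynomial $g\in R[t]$ of degree $k$. -}

module Defs where

open import Level using (Level; _⊔_)
open import Data.Nat using (ℕ; zero; suc; _<_)
open import Data.List using (List; []; _∷_; map; foldr)
open import Data.Product using (Σ; ∃; _×_; _,_; proj₁; proj₂)
open import Data.Sum using (_⊎_)
open import Relation.Nullary using (¬_)
open import Algebra.Bundles using (CommutativeRing)
open import Algebra.Bundles.Raw using (RawRing)

-- Univariate polynomials over a (raw) ring, as coefficient lists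
-- (constant term first).  Equality is coefficientwise (so trailing
-- zeros are irrelevant).

module Poly {c ℓ} (A : RawRing c ℓ) where
  open RawRing A

  Pol : Set c
  Pol = List Carrier

  coeff : Pol → ℕ → Carrier
  coeff []      _       = 0#
  coeff (a ∷ p) zero    = a
  coeff (a ∷ p) (suc n) = coeff p n

  infix 4 _≈ₚ_
  _≈ₚ_ : Pol → Pol → Set ℓ
  p ≈ₚ q = ∀ n → coeff p n ≈ coeff q n

  infixl 6 _+ₚ_
  _+ₚ_ : Pol → Pol → Pol
  []      +ₚ q       = q
  (a ∷ p) +ₚ []      = a ∷ p
  (a ∷ p) +ₚ (b ∷ q) = (a + b) ∷ (p +ₚ q)

  scale : Carrier → Pol → Pol
  scale a = map (a *_)

  infixl 7 _*ₚ_
  _*ₚ_ : Pol → Pol → Pol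
  []      *ₚ q = []
  (a ∷ p) *ₚ q = scale a q +ₚ (0# ∷ (p *ₚ q))

  _∘ₚ_ : Pol → Pol → Pol
  f ∘ₚ g = foldr (λ a acc → (a ∷ []) +ₚ (g *ₚ acc)) [] f

  HasDegree : Pol → ℕ → Set ℓ
  HasDegree p d = (¬ coeff p d ≈ 0#) × (∀ n → d < n → coeff p n ≈ 0#)

  IsUnit : Pol → Set (c ⊔ ℓ)
  IsUnit p = Σ Pol λ q → p *ₚ q ≈ₚ (1# ∷ [])

  Irreducible : Pol → Set (c ⊔ ℓ)
  Irreducible p = (¬ IsUnit p) × (∀ a b → p ≈ₚ a *ₚ b → IsUnit a ⊎ IsUnit b)

record IsDomain {c ℓ} (R : CommutativeRing c ℓ) : Set (c ⊔ ℓ) where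
  open CommutativeRing R
  field
    1≉0       : ¬ 1# ≈ 0#
    noZeroDiv : ∀ x y → ¬ x ≈ 0# → ¬ y ≈ 0# → ¬ (x * y) ≈ 0#

module Frac {c ℓ} (R : CommutativeRing c ℓ) (D : IsDomain R) where
  open CommutativeRing R
  open IsDomain D

  FCarrier : Set (c ⊔ ℓ)
  FCarrier = Σ (Carrier × Carrier) λ ab → ¬ proj₂ ab ≈ 0#

  fracRawRing : RawRing (c ⊔ ℓ) ℓ
  fracRawRing = record
    { Carrier = FCarrier
    ; _≈_ = λ { ((a , b) , _) ((a' , b') , _) → a * b' ≈ a' * b }
    ; _+_ = λ { ((a , b) , b≠0) ((a' , b') , b'≠0) →
                 ((a * b' + a' * b) , (b * b')) , noZeroDiv b b' b≠0 b'≠0 }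
    ; _*_ = λ { ((a , b) , b≠0) ((a' , b') , b'≠0) →
                 ((a * a') , (b * b')) , noZeroDiv b b' b≠0 b'≠0 }
    ; -_  = λ { ((a , b) , b≠0) → ((- a) , b) , b≠0 }
    ; 0#  = (0# , 1#) , 1≉0
    ; 1#  = (1# , 1#) , 1≉0
    }

  ι : Carrier → FCarrier
  ι r = (r , 1#) , 1≉0

module _ {c ℓ} (R : CommutativeRing c ℓ) (D : IsDomain R) where
  private
    module PR = Poly (CommutativeRing.rawRing R)
    module FR = Frac R D
    module PF = Poly FR.fracRawRing

  WeaklySuperirreducible : ℕ → PR.Pol → Set (c ⊔ ℓ)
  WeaklySuperirreducible k f =
    ∀ (g : PR.Pol) → PR.HasDegree g k → PF.Irreducible (map FR.ι (f PR.∘ₚ g))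

-- Put g = X + f·X^(k−d), a polynomial of degree k.  Since g ≡ X modulo f, also
-- f(g) ≡ f(X) ≡ 0 modulo f, i.e. f(g) = f·b in R[X].  Over the fraction field,
-- f has degree d ≥ 2 and f(g) has degree dk > d, so neither f nor b is a unit
-- and f(g) is reducible.  Constructively, the degree of a polynomial over the
-- fraction field exists only under double negation, which is enough because
-- the goal is a negation.

module Submission where

open import Defs
open import Level using (_⊔_) renaming (suc to lsuc)
open import Data.Nat as ℕ using (ℕ; zero; suc; _≤_; _<_; z≤n; s≤s)
import Data.Nat.Properties as ℕ
open import Data.Empty using (⊥-elim)
open import Data.List using ([]; _∷_; map)
open import Data.List.Relation.Binary.Pointwise using (Pointwise; []; _∷_)
open import Data.Product using (Σ; _×_; _,_; proj₁; proj₂)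
open import Data.Sum using (_⊎_; inj₁; inj₂)
open import Function using (_∘_)
open import Relation.Nullary using (¬_; yes; no; ¬¬-excluded-middle)
open import Relation.Binary.PropositionalEquality as ≡ using (_≡_)
open import Relation.Binary.Structures using (IsEquivalence)
open import Relation.Binary.Bundles using (Setoid)
open import Algebra.Bundles using (CommutativeRing; CommutativeSemiring; CommutativeMonoid)
open import Algebra.Bundles.Raw using (RawRing)
import Algebra.Properties.CommutativeSemigroup as CommSemigroupProperties
import Algebra.Solver.Ring.NaturalCoefficients.Default as CommSemiringSolver
import Relation.Binary.Reasoning.Setoid as SetoidReasoning

-- The predicate "x is sent to 0" for a ring map from A into an integral domain;
-- degrees over R and over its fraction field are both computed from it.
record ZeroTest {c ℓ} (A : RawRing c ℓ) ℓz : Set (c ⊔ ℓ ⊔ lsuc ℓz) where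
  open RawRing A
  field
    IsZero     : Carrier → Set ℓz
    0-isZero   : IsZero 0#
    1-nonZero  : ¬ IsZero 1#
    +-isZero   : ∀ {x y} → IsZero x → IsZero y → IsZero (x + y)
    +-nonZeroˡ : ∀ {x y} → ¬ IsZero x → IsZero y → ¬ IsZero (x + y)
    +-nonZeroʳ : ∀ {x y} → IsZero x → ¬ IsZero y → ¬ IsZero (x + y)
    *-isZeroˡ  : ∀ {x} y → IsZero x → IsZero (x * y)
    *-isZeroʳ  : ∀ x {y} → IsZero y → IsZero (x * y)
    *-nonZero  : ∀ {x y} → ¬ IsZero x → ¬ IsZero y → ¬ IsZero (x * y)
    ≈-nonZeroʳ : ∀ {x y} → x ≈ y → ¬ IsZero x → ¬ IsZero y
    ≈-nonZeroˡ : ∀ {x y} → x ≈ y → ¬ IsZero y → ¬ IsZero x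

module Degree {c ℓ ℓz} {A : RawRing c ℓ} (Z : ZeroTest A ℓz) where
  open RawRing A using (0#)
  open Poly A hiding (HasDegree)
  open ZeroTest Z

  IsZeroₚ : Pol → Set ℓz
  IsZeroₚ p = ∀ n → IsZero (coeff p n)

  DegreeBelow : Pol → ℕ → Set ℓz
  DegreeBelow p d = ∀ n → d ≤ n → IsZero (coeff p n)

  HasDegree : Pol → ℕ → Set ℓz
  HasDegree p d = ¬ IsZero (coeff p d) × DegreeBelow p (suc d)

  isZeroₚ⇒degreeBelow : ∀ p d → IsZeroₚ p → DegreeBelow p d
  isZeroₚ⇒degreeBelow p d z n _ = z n

  degreeBelow-mono : ∀ p {d e} → d ≤ e → DegreeBelow p d → DegreeBelow p e
  degreeBelow-mono p d≤e below n e≤n = below n (ℕ.≤-trans d≤e e≤n)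

  hasDegree-∷⁻ : ∀ {a p d} → HasDegree (a ∷ p) (suc d) → HasDegree p d
  hasDegree-∷⁻ (nz , below) = nz , λ n d<n → below (suc n) (s≤s d<n)

  hasDegree-∷⁺ : ∀ a {p d} → HasDegree p d → HasDegree (a ∷ p) (suc d)
  hasDegree-∷⁺ a (nz , below) = nz , λ { (suc n) (s≤s d<n) → below n d<n }

  hasDegreeZero-∷⁻ : ∀ {a p} → HasDegree (a ∷ p) 0 → ¬ IsZero a × IsZeroₚ p
  hasDegreeZero-∷⁻ (nz , below) = nz , λ n → below (suc n) (s≤s z≤n)

  +ₚ-isZero : ∀ p q n → IsZero (coeff p n) → IsZero (coeff q n) → IsZero (coeff (p +ₚ q) n)
  +ₚ-isZero []      q       n       _  zq = zq
  +ₚ-isZero (a ∷ p) []      n       zp _  = zp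
  +ₚ-isZero (a ∷ p) (b ∷ q) zero    zp zq = +-isZero zp zq
  +ₚ-isZero (a ∷ p) (b ∷ q) (suc n) zp zq = +ₚ-isZero p q n zp zq

  +ₚ-nonZeroˡ : ∀ p q n → ¬ IsZero (coeff p n) → IsZero (coeff q n) →
                ¬ IsZero (coeff (p +ₚ q) n)
  +ₚ-nonZeroˡ []      q       n       np _  = λ _ → np 0-isZero
  +ₚ-nonZeroˡ (a ∷ p) []      n       np _  = np
  +ₚ-nonZeroˡ (a ∷ p) (b ∷ q) zero    np zq = +-nonZeroˡ np zq
  +ₚ-nonZeroˡ (a ∷ p) (b ∷ q) (suc n) np zq = +ₚ-nonZeroˡ p q n np zq

  +ₚ-nonZeroʳ : ∀ p q n → IsZero (coeff p n) → ¬ IsZero (coeff q n) →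
                ¬ IsZero (coeff (p +ₚ q) n)
  +ₚ-nonZeroʳ []      q       n       _  nq = nq
  +ₚ-nonZeroʳ (a ∷ p) []      n       _  nq = λ _ → nq 0-isZero
  +ₚ-nonZeroʳ (a ∷ p) (b ∷ q) zero    zp nq = +-nonZeroʳ zp nq
  +ₚ-nonZeroʳ (a ∷ p) (b ∷ q) (suc n) zp nq = +ₚ-nonZeroʳ p q n zp nq

  +ₚ-isZeroₚ : ∀ p q → IsZeroₚ p → IsZeroₚ q → IsZeroₚ (p +ₚ q)
  +ₚ-isZeroₚ p q zp zq n = +ₚ-isZero p q n (zp n) (zq n)

  +ₚ-hasDegreeˡ : ∀ p q {d} → HasDegree p d → DegreeBelow q d → HasDegree (p +ₚ q) d
  +ₚ-hasDegreeˡ p q {d} (nz , below) belowq =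
    +ₚ-nonZeroˡ p q d nz (belowq d ℕ.≤-refl) ,
    λ n d<n → +ₚ-isZero p q n (below n d<n) (belowq n (ℕ.<⇒≤ d<n))

  +ₚ-hasDegreeʳ : ∀ p q {d} → DegreeBelow p d → HasDegree q d → HasDegree (p +ₚ q) d
  +ₚ-hasDegreeʳ p q {d} belowp (nz , below) =
    +ₚ-nonZeroʳ p q d (belowp d ℕ.≤-refl) nz ,
    λ n d<n → +ₚ-isZero p q n (belowp n (ℕ.<⇒≤ d<n)) (below n d<n)

  scale-isZeroˡ : ∀ {a} q n → IsZero a → IsZero (coeff (scale a q) n)
  scale-isZeroˡ []      n       _  = 0-isZero
  scale-isZeroˡ (b ∷ q) zero    za = *-isZeroˡ b za
  scale-isZeroˡ (b ∷ q) (suc n) za = scale-isZeroˡ q n za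

  scale-isZeroʳ : ∀ a q n → IsZero (coeff q n) → IsZero (coeff (scale a q) n)
  scale-isZeroʳ a []      n       _  = 0-isZero
  scale-isZeroʳ a (b ∷ q) zero    zq = *-isZeroʳ a zq
  scale-isZeroʳ a (b ∷ q) (suc n) zq = scale-isZeroʳ a q n zq

  scale-nonZero : ∀ {a} q n → ¬ IsZero a → ¬ IsZero (coeff q n) → ¬ IsZero (coeff (scale a q) n)
  scale-nonZero []      n       _  nq = λ _ → nq 0-isZero
  scale-nonZero (b ∷ q) zero    na nq = *-nonZero na nq
  scale-nonZero (b ∷ q) (suc n) na nq = scale-nonZero q n na nq

  scale-hasDegree : ∀ {a} q {d} → ¬ IsZero a → HasDegree q d → HasDegree (scale a q) d
  scale-hasDegree {a} q {d} na (nz , below) =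
    scale-nonZero q d na nz , λ n d<n → scale-isZeroʳ a q n (below n d<n)

  scale-degreeBelow : ∀ a q {d} → DegreeBelow q d → DegreeBelow (scale a q) d
  scale-degreeBelow a q below n d≤n = scale-isZeroʳ a q n (below n d≤n)

  0∷-isZeroₚ : ∀ p → IsZeroₚ p → IsZeroₚ (0# ∷ p)
  0∷-isZeroₚ p z zero    = 0-isZero
  0∷-isZeroₚ p z (suc n) = z n

  *ₚ-isZeroₚˡ : ∀ p q → IsZeroₚ p → IsZeroₚ (p *ₚ q)
  *ₚ-isZeroₚˡ []      q zp = λ _ → 0-isZero
  *ₚ-isZeroₚˡ (a ∷ p) q zp =
    +ₚ-isZeroₚ (scale a q) (0# ∷ p *ₚ q) (λ n → scale-isZeroˡ q n (zp 0))
               (0∷-isZeroₚ (p *ₚ q) (*ₚ-isZeroₚˡ p q (λ n → zp (suc n))))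

  *ₚ-isZeroₚʳ : ∀ p q → IsZeroₚ q → IsZeroₚ (p *ₚ q)
  *ₚ-isZeroₚʳ []      q zq = λ _ → 0-isZero
  *ₚ-isZeroₚʳ (a ∷ p) q zq =
    +ₚ-isZeroₚ (scale a q) (0# ∷ p *ₚ q) (λ n → scale-isZeroʳ a q n (zq n))
               (0∷-isZeroₚ (p *ₚ q) (*ₚ-isZeroₚʳ p q zq))

  *ₚ-hasDegree : ∀ p q {d e} → HasDegree p d → HasDegree q e → HasDegree (p *ₚ q) (d ℕ.+ e)
  *ₚ-hasDegree []      q (nz , _) _ = ⊥-elim (nz 0-isZero)
  *ₚ-hasDegree (a ∷ p) q {zero}  degp degq =
    let na , zp = hasDegreeZero-∷⁻ degp in
    +ₚ-hasDegreeˡ (scale a q) (0# ∷ p *ₚ q) (scale-hasDegree q na degq)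
      (isZeroₚ⇒degreeBelow (0# ∷ p *ₚ q) _ (0∷-isZeroₚ (p *ₚ q) (*ₚ-isZeroₚˡ p q zp)))
  *ₚ-hasDegree (a ∷ p) q {suc d} {e} degp degq =
    +ₚ-hasDegreeʳ (scale a q) (0# ∷ p *ₚ q)
      (degreeBelow-mono (scale a q) (s≤s (ℕ.m≤n+m e d)) (scale-degreeBelow a q (proj₂ degq)))
      (hasDegree-∷⁺ 0# (*ₚ-hasDegree p q (hasDegree-∷⁻ degp) degq))

  isZeroₚ-or-hasDegree : ∀ p → ¬ ¬ (IsZeroₚ p ⊎ Σ ℕ (HasDegree p))
  isZeroₚ-or-hasDegree []      k = k (inj₁ λ _ → 0-isZero)
  isZeroₚ-or-hasDegree (a ∷ p) k = isZeroₚ-or-hasDegree p λ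
    { (inj₂ (d , degp)) → k (inj₂ (suc d , hasDegree-∷⁺ a degp))
    ; (inj₁ zp) → ¬¬-excluded-middle λ
        { (yes za) → k (inj₁ λ { zero → za ; (suc n) → zp n })
        ; (no na)  → k (inj₂ (0 , na , λ { (suc n) _ → zp n })) } }

  const-degreeBelow : ∀ a → DegreeBelow (a ∷ []) 1
  const-degreeBelow a (suc n) _ = 0-isZero

  ∘ₚ-isZeroₚ : ∀ f g → IsZeroₚ f → IsZeroₚ (f ∘ₚ g)
  ∘ₚ-isZeroₚ []      g zf = λ _ → 0-isZero
  ∘ₚ-isZeroₚ (a ∷ f) g zf =
    +ₚ-isZeroₚ (a ∷ []) (g *ₚ (f ∘ₚ g)) (λ { zero → zf 0 ; (suc n) → 0-isZero })
               (*ₚ-isZeroₚʳ g (f ∘ₚ g) (∘ₚ-isZeroₚ f g (λ n → zf (suc n))))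

  ∘ₚ-hasDegree : ∀ f g {d k} → HasDegree f d → HasDegree g (suc k) →
                 HasDegree (f ∘ₚ g) (d ℕ.* suc k)
  ∘ₚ-hasDegree []      g (nz , _) _ = ⊥-elim (nz 0-isZero)
  ∘ₚ-hasDegree (a ∷ f) g {zero} degf degg =
    let na , zf = hasDegreeZero-∷⁻ degf in
    +ₚ-hasDegreeˡ (a ∷ []) (g *ₚ (f ∘ₚ g)) (na , const-degreeBelow a)
      (isZeroₚ⇒degreeBelow (g *ₚ (f ∘ₚ g)) 0
        (*ₚ-isZeroₚʳ g (f ∘ₚ g) (∘ₚ-isZeroₚ f g zf)))
  ∘ₚ-hasDegree (a ∷ f) g {suc d} degf degg =
    +ₚ-hasDegreeʳ (a ∷ []) (g *ₚ (f ∘ₚ g))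
      (degreeBelow-mono (a ∷ []) (s≤s z≤n) (const-degreeBelow a))
      (*ₚ-hasDegree g (f ∘ₚ g) degg (∘ₚ-hasDegree f g (hasDegree-∷⁻ degf) degg))

  hasDegree-suc⇒¬IsUnit : ∀ p {m} → HasDegree p (suc m) → ¬ IsUnit p
  hasDegree-suc⇒¬IsUnit p {m} degp (q , pq≈1) = isZeroₚ-or-hasDegree q λ
    { (inj₁ zq) → ≈-nonZeroˡ (pq≈1 0) 1-nonZero (*ₚ-isZeroₚʳ p q zq 0)
    ; (inj₂ (e , degq)) →
        ≈-nonZeroʳ (pq≈1 (suc m ℕ.+ e)) (proj₁ (*ₚ-hasDegree p q degp degq)) 0-isZero }

  properFactor⇒¬Irreducible : ∀ P a b {n m} → HasDegree P n → HasDegree a (suc m) → suc m < n →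
                              P ≈ₚ a *ₚ b → ¬ Irreducible P
  properFactor⇒¬Irreducible P a b {n} {m} degP dega a<P P≈ab (_ , split) with split a b P≈ab
  ... | inj₁ unit-a = hasDegree-suc⇒¬IsUnit a dega unit-a
  ... | inj₂ unit-b = isZeroₚ-or-hasDegree b λ
    { (inj₁ zb)            → ab-nonZero-at-n (*ₚ-isZeroₚʳ a b zb n)
    ; (inj₂ (zero , degb)) → ab-nonZero-at-n (proj₂ (*ₚ-hasDegree a b dega degb) n
                               (≡.subst (_< n) (≡.sym (ℕ.+-identityʳ (suc m))) a<P))
    ; (inj₂ (suc e , degb)) → hasDegree-suc⇒¬IsUnit b degb unit-b }
    where
    ab-nonZero-at-n : ¬ IsZero (coeff (a *ₚ b) n)
    ab-nonZero-at-n = ≈-nonZeroʳ (P≈ab n) (proj₁ degP)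

module PolynomialSemiring {c ℓ} (R : CommutativeRing c ℓ) where
  open CommutativeRing R
  open Poly rawRing

  -- A record, so that p and q can be recovered from p ≋ q by unification.
  infix 4 _≋_
  record _≋_ (p q : Pol) : Set ℓ where
    constructor coeffwise
    field coeff-≈ : p ≈ₚ q
  open _≋_ public

  open import Algebra.Structures {A = Pol} _≋_ using (IsCommutativeMonoid)
  open import Algebra.Structures.Biased {A = Pol} _≋_
    using (isCommutativeMonoidˡ; isCommutativeSemiringˡ)

  coeff-+ₚ : ∀ p q n → coeff (p +ₚ q) n ≈ coeff p n + coeff q n
  coeff-+ₚ []      q       n       = sym (+-identityˡ _)
  coeff-+ₚ (a ∷ p) []      n       = sym (+-identityʳ _)
  coeff-+ₚ (a ∷ p) (b ∷ q) zero    = refl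
  coeff-+ₚ (a ∷ p) (b ∷ q) (suc n) = coeff-+ₚ p q n

  coeff-scale : ∀ a q n → coeff (scale a q) n ≈ a * coeff q n
  coeff-scale a []      n       = sym (zeroʳ a)
  coeff-scale a (b ∷ q) zero    = refl
  coeff-scale a (b ∷ q) (suc n) = coeff-scale a q n

  ≋-isEquivalence : IsEquivalence _≋_
  ≋-isEquivalence = record
    { refl  = coeffwise λ _ → refl
    ; sym   = λ p≋q → coeffwise λ n → sym (coeff-≈ p≋q n)
    ; trans = λ p≋q q≋r → coeffwise λ n → trans (coeff-≈ p≋q n) (coeff-≈ q≋r n)
    }

  ≋-setoid : Setoid c ℓ
  ≋-setoid = record { isEquivalence = ≋-isEquivalence }

  open IsEquivalence ≋-isEquivalence public using ()
    renaming (refl to ≋-refl; sym to ≋-sym; trans to ≋-trans)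

  module ≈-Reasoning = SetoidReasoning setoid
  module ≋-Reasoning = SetoidReasoning ≋-setoid

  ∷-cong : ∀ {a b p q} → a ≈ b → p ≋ q → a ∷ p ≋ b ∷ q
  ∷-cong a≈b p≋q = coeffwise λ { zero → a≈b ; (suc n) → coeff-≈ p≋q n }

  +ₚ-cong : ∀ {p p′ q q′} → p ≋ p′ → q ≋ q′ → p +ₚ q ≋ p′ +ₚ q′
  +ₚ-cong {p} {p′} {q} {q′} p≋p′ q≋q′ = coeffwise λ n → begin
    coeff (p +ₚ q) n        ≈⟨ coeff-+ₚ p q n ⟩
    coeff p n + coeff q n   ≈⟨ +-cong (coeff-≈ p≋p′ n) (coeff-≈ q≋q′ n) ⟩
    coeff p′ n + coeff q′ n ≈⟨ coeff-+ₚ p′ q′ n ⟨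
    coeff (p′ +ₚ q′) n      ∎
    where open ≈-Reasoning

  +ₚ-congˡ : ∀ p {q q′} → q ≋ q′ → p +ₚ q ≋ p +ₚ q′
  +ₚ-congˡ p = +ₚ-cong (≋-refl {p})

  +ₚ-congʳ : ∀ r {p p′} → p ≋ p′ → p +ₚ r ≋ p′ +ₚ r
  +ₚ-congʳ r p≋p′ = +ₚ-cong p≋p′ (≋-refl {r})

  +ₚ-assoc : ∀ p q r → (p +ₚ q) +ₚ r ≋ p +ₚ (q +ₚ r)
  +ₚ-assoc p q r = coeffwise λ n → begin
    coeff ((p +ₚ q) +ₚ r) n
      ≈⟨ trans (coeff-+ₚ (p +ₚ q) r n) (+-congʳ (coeff-+ₚ p q n)) ⟩
    (coeff p n + coeff q n) + coeff r n
      ≈⟨ +-assoc _ _ _ ⟩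
    coeff p n + (coeff q n + coeff r n)
      ≈⟨ trans (coeff-+ₚ p (q +ₚ r) n) (+-congˡ (coeff-+ₚ q r n)) ⟨
    coeff (p +ₚ (q +ₚ r)) n
      ∎
    where open ≈-Reasoning

  +ₚ-comm : ∀ p q → p +ₚ q ≋ q +ₚ p
  +ₚ-comm p q = coeffwise λ n → begin
    coeff (p +ₚ q) n      ≈⟨ coeff-+ₚ p q n ⟩
    coeff p n + coeff q n ≈⟨ +-comm _ _ ⟩
    coeff q n + coeff p n ≈⟨ coeff-+ₚ q p n ⟨
    coeff (q +ₚ p) n      ∎
    where open ≈-Reasoning

  +ₚ-identityʳ : ∀ p → p +ₚ [] ≋ p
  +ₚ-identityʳ p = coeffwise λ n → trans (coeff-+ₚ p [] n) (+-identityʳ _)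

  +ₚ-isCommutativeMonoid : IsCommutativeMonoid _+ₚ_ []
  +ₚ-isCommutativeMonoid = isCommutativeMonoidˡ record
    { isSemigroup = record
      { isMagma = record { isEquivalence = ≋-isEquivalence ; ∙-cong = +ₚ-cong }
      ; assoc   = +ₚ-assoc
      }
    ; identityˡ = λ _ → ≋-refl
    ; comm      = +ₚ-comm
    }

  +ₚ-commutativeMonoid : CommutativeMonoid c ℓ
  +ₚ-commutativeMonoid = record { isCommutativeMonoid = +ₚ-isCommutativeMonoid }

  open CommSemigroupProperties (CommutativeMonoid.commutativeSemigroup +ₚ-commutativeMonoid)
    using () renaming (interchange to +ₚ-interchange; x∙yz≈y∙xz to +ₚ-leftComm)

  0∷-+ₚ : ∀ p q → (0# ∷ p) +ₚ (0# ∷ q) ≋ 0# ∷ (p +ₚ q)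
  0∷-+ₚ p q = ∷-cong (+-identityʳ 0#) ≋-refl

  scale-cong : ∀ a {p q} → p ≋ q → scale a p ≋ scale a q
  scale-cong a {p} {q} p≋q = coeffwise λ n →
    trans (coeff-scale a p n) (trans (*-congˡ (coeff-≈ p≋q n)) (sym (coeff-scale a q n)))

  scale-distribˡ : ∀ a p q → scale a (p +ₚ q) ≋ scale a p +ₚ scale a q
  scale-distribˡ a p q = coeffwise λ n → begin
    coeff (scale a (p +ₚ q)) n
      ≈⟨ trans (coeff-scale a (p +ₚ q) n) (*-congˡ (coeff-+ₚ p q n)) ⟩
    a * (coeff p n + coeff q n)
      ≈⟨ distribˡ a _ _ ⟩
    a * coeff p n + a * coeff q n
      ≈⟨ +-cong (coeff-scale a p n) (coeff-scale a q n) ⟨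
    coeff (scale a p) n + coeff (scale a q) n
      ≈⟨ coeff-+ₚ (scale a p) (scale a q) n ⟨
    coeff (scale a p +ₚ scale a q) n
      ∎
    where open ≈-Reasoning

  scale-distribʳ : ∀ a b p → scale (a + b) p ≋ scale a p +ₚ scale b p
  scale-distribʳ a b p = coeffwise λ n → begin
    coeff (scale (a + b) p) n                 ≈⟨ coeff-scale (a + b) p n ⟩
    (a + b) * coeff p n                       ≈⟨ distribʳ _ a b ⟩
    a * coeff p n + b * coeff p n             ≈⟨ +-cong (coeff-scale a p n) (coeff-scale b p n) ⟨
    coeff (scale a p) n + coeff (scale b p) n ≈⟨ coeff-+ₚ (scale a p) (scale b p) n ⟨
    coeff (scale a p +ₚ scale b p) n          ∎
    where open ≈-Reasoning

  scale-scale : ∀ a b p → scale a (scale b p) ≋ scale (a * b) p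
  scale-scale a b p = coeffwise λ n → begin
    coeff (scale a (scale b p)) n
      ≈⟨ trans (coeff-scale a (scale b p) n) (*-congˡ (coeff-scale b p n)) ⟩
    a * (b * coeff p n)
      ≈⟨ *-assoc a b _ ⟨
    (a * b) * coeff p n
      ≈⟨ coeff-scale (a * b) p n ⟨
    coeff (scale (a * b) p) n
      ∎
    where open ≈-Reasoning

  scale-0# : ∀ p → scale 0# p ≋ []
  scale-0# p = coeffwise λ n → trans (coeff-scale 0# p n) (zeroˡ _)

  scale-1# : ∀ p → scale 1# p ≋ p
  scale-1# p = coeffwise λ n → trans (coeff-scale 1# p n) (*-identityˡ _)

  scale-0∷ : ∀ a p → scale a (0# ∷ p) ≋ 0# ∷ scale a p
  scale-0∷ a p = ∷-cong (zeroʳ a) ≋-refl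

  *ₚ-congˡ : ∀ p {q q′} → q ≋ q′ → p *ₚ q ≋ p *ₚ q′
  *ₚ-congˡ []      q≋q′ = ≋-refl
  *ₚ-congˡ (a ∷ p) q≋q′ = +ₚ-cong (scale-cong a q≋q′) (∷-cong refl (*ₚ-congˡ p q≋q′))

  *ₚ-zeroʳ : ∀ p → p *ₚ [] ≋ []
  *ₚ-zeroʳ []      = ≋-refl
  *ₚ-zeroʳ (a ∷ p) = coeffwise λ { zero → refl ; (suc n) → coeff-≈ (*ₚ-zeroʳ p) n }

  *ₚ-∷ʳ : ∀ p b q → p *ₚ (b ∷ q) ≋ scale b p +ₚ (0# ∷ p *ₚ q)
  *ₚ-∷ʳ []      b q = coeffwise λ { zero → refl ; (suc n) → refl }
  *ₚ-∷ʳ (a ∷ p) b q = ∷-cong (+-congʳ (*-comm a b)) (begin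
    scale a q +ₚ p *ₚ (b ∷ q)                 ≈⟨ +ₚ-congˡ (scale a q) (*ₚ-∷ʳ p b q) ⟩
    scale a q +ₚ (scale b p +ₚ (0# ∷ p *ₚ q)) ≈⟨ +ₚ-leftComm (scale a q) (scale b p) _ ⟩
    scale b p +ₚ (scale a q +ₚ (0# ∷ p *ₚ q)) ∎)
    where open ≋-Reasoning

  *ₚ-comm : ∀ p q → p *ₚ q ≋ q *ₚ p
  *ₚ-comm []      q = ≋-sym (*ₚ-zeroʳ q)
  *ₚ-comm (a ∷ p) q = begin
    scale a q +ₚ (0# ∷ p *ₚ q) ≈⟨ +ₚ-congˡ (scale a q) (∷-cong refl (*ₚ-comm p q)) ⟩
    scale a q +ₚ (0# ∷ q *ₚ p) ≈⟨ *ₚ-∷ʳ q a p ⟨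
    q *ₚ (a ∷ p)               ∎
    where open ≋-Reasoning

  *ₚ-cong : ∀ {p p′ q q′} → p ≋ p′ → q ≋ q′ → p *ₚ q ≋ p′ *ₚ q′
  *ₚ-cong {p} {p′} {q} {q′} p≋p′ q≋q′ = begin
    p *ₚ q   ≈⟨ *ₚ-comm p q ⟩
    q *ₚ p   ≈⟨ *ₚ-congˡ q p≋p′ ⟩
    q *ₚ p′  ≈⟨ *ₚ-comm q p′ ⟩
    p′ *ₚ q  ≈⟨ *ₚ-congˡ p′ q≋q′ ⟩
    p′ *ₚ q′ ∎
    where open ≋-Reasoning

  *ₚ-distribʳ : ∀ r p q → (p +ₚ q) *ₚ r ≋ p *ₚ r +ₚ q *ₚ r
  *ₚ-distribʳ r []      q       = ≋-refl
  *ₚ-distribʳ r (a ∷ p) []      = ≋-sym (+ₚ-identityʳ _)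
  *ₚ-distribʳ r (a ∷ p) (b ∷ q) = begin
    scale (a + b) r +ₚ (0# ∷ (p +ₚ q) *ₚ r)
      ≈⟨ +ₚ-cong (scale-distribʳ a b r) (∷-cong refl (*ₚ-distribʳ r p q)) ⟩
    (scale a r +ₚ scale b r) +ₚ (0# ∷ (p *ₚ r +ₚ q *ₚ r))
      ≈⟨ +ₚ-congˡ (scale a r +ₚ scale b r) (0∷-+ₚ (p *ₚ r) (q *ₚ r)) ⟨
    (scale a r +ₚ scale b r) +ₚ ((0# ∷ p *ₚ r) +ₚ (0# ∷ q *ₚ r))
      ≈⟨ +ₚ-interchange (scale a r) (scale b r) _ _ ⟩
    (scale a r +ₚ (0# ∷ p *ₚ r)) +ₚ (scale b r +ₚ (0# ∷ q *ₚ r))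
      ∎
    where open ≋-Reasoning

  0∷-*ₚ : ∀ p q → (0# ∷ p) *ₚ q ≋ 0# ∷ (p *ₚ q)
  0∷-*ₚ p q = +ₚ-congʳ (0# ∷ p *ₚ q) (scale-0# q)

  scale-*ₚ : ∀ a p q → scale a p *ₚ q ≋ scale a (p *ₚ q)
  scale-*ₚ a []      q = ≋-refl
  scale-*ₚ a (b ∷ p) q = begin
    scale (a * b) q +ₚ (0# ∷ scale a p *ₚ q)
      ≈⟨ +ₚ-cong (scale-scale a b q) (∷-cong refl (≋-sym (scale-*ₚ a p q))) ⟨
    scale a (scale b q) +ₚ (0# ∷ scale a (p *ₚ q))
      ≈⟨ +ₚ-congˡ (scale a (scale b q)) (scale-0∷ a (p *ₚ q)) ⟨
    scale a (scale b q) +ₚ scale a (0# ∷ p *ₚ q)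
      ≈⟨ scale-distribˡ a (scale b q) _ ⟨
    scale a (scale b q +ₚ (0# ∷ p *ₚ q))
      ∎
    where open ≋-Reasoning

  *ₚ-assoc : ∀ p q r → (p *ₚ q) *ₚ r ≋ p *ₚ (q *ₚ r)
  *ₚ-assoc []      q r = ≋-refl
  *ₚ-assoc (a ∷ p) q r = begin
    (scale a q +ₚ (0# ∷ p *ₚ q)) *ₚ r
      ≈⟨ *ₚ-distribʳ r (scale a q) _ ⟩
    scale a q *ₚ r +ₚ (0# ∷ p *ₚ q) *ₚ r
      ≈⟨ +ₚ-cong (scale-*ₚ a q r) (0∷-*ₚ (p *ₚ q) r) ⟩
    scale a (q *ₚ r) +ₚ (0# ∷ (p *ₚ q) *ₚ r)
      ≈⟨ +ₚ-congˡ (scale a (q *ₚ r)) (∷-cong refl (*ₚ-assoc p q r)) ⟩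
    scale a (q *ₚ r) +ₚ (0# ∷ p *ₚ (q *ₚ r)) ∎
    where open ≋-Reasoning

  *ₚ-identityˡ : ∀ p → (1# ∷ []) *ₚ p ≋ p
  *ₚ-identityˡ p = begin
    scale 1# p +ₚ (0# ∷ []) ≈⟨ +ₚ-congˡ (scale 1# p) 0∷[]≋[] ⟩
    scale 1# p +ₚ []        ≈⟨ +ₚ-identityʳ (scale 1# p) ⟩
    scale 1# p              ≈⟨ scale-1# p ⟩
    p                       ∎
    where
    open ≋-Reasoning
    0∷[]≋[] : 0# ∷ [] ≋ []
    0∷[]≋[] = coeffwise λ { zero → refl ; (suc n) → refl }

  polynomialSemiring : CommutativeSemiring c ℓ
  polynomialSemiring = record
    { _+_ = _+ₚ_
    ; _*_ = _*ₚ_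
    ; 0#  = []
    ; 1#  = 1# ∷ []
    ; isCommutativeSemiring = isCommutativeSemiringˡ record
      { +-isCommutativeMonoid = +ₚ-isCommutativeMonoid
      ; *-isCommutativeMonoid = isCommutativeMonoidˡ record
        { isSemigroup = record
          { isMagma = record { isEquivalence = ≋-isEquivalence ; ∙-cong = *ₚ-cong }
          ; assoc   = *ₚ-assoc
          }
        ; identityˡ = *ₚ-identityˡ
        ; comm      = *ₚ-comm
        }
      ; distribʳ = *ₚ-distribʳ
      ; zeroˡ    = λ _ → ≋-refl
      }
    }

  open CommSemiringSolver polynomialSemiring

  X^ : ℕ → Pol
  X^ zero    = 1# ∷ []
  X^ (suc e) = 0# ∷ X^ e

  X*ₚ : ∀ p → X^ 1 *ₚ p ≋ 0# ∷ p
  X*ₚ p = ≋-trans (0∷-*ₚ (1# ∷ []) p) (∷-cong refl (*ₚ-identityˡ p))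

  ∘ₚ-translate : ∀ f h → Σ Pol λ r → f ∘ₚ (X^ 1 +ₚ h) ≋ f +ₚ h *ₚ r
  ∘ₚ-translate []      h = [] , ≋-sym (*ₚ-zeroʳ h)
  ∘ₚ-translate (a ∷ f) h with ∘ₚ-translate f h
  ... | r , f∘g≋f+hr = f +ₚ g *ₚ r , (begin
    (a ∷ []) +ₚ g *ₚ (f ∘ₚ g)
      ≈⟨ +ₚ-congˡ (a ∷ []) (*ₚ-congˡ g f∘g≋f+hr) ⟩
    (a ∷ []) +ₚ g *ₚ (f +ₚ h *ₚ r)
      ≈⟨ expand (a ∷ []) (X^ 1) h f r ⟩
    ((a ∷ []) +ₚ X^ 1 *ₚ f) +ₚ h *ₚ (f +ₚ g *ₚ r)
      ≈⟨ +ₚ-congʳ (h *ₚ (f +ₚ g *ₚ r)) (+ₚ-congˡ (a ∷ []) (X*ₚ f)) ⟩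
    ((a ∷ []) +ₚ (0# ∷ f)) +ₚ h *ₚ (f +ₚ g *ₚ r)
      ≈⟨ +ₚ-congʳ (h *ₚ (f +ₚ g *ₚ r)) (∷-cong (+-identityʳ a) ≋-refl) ⟩
    (a ∷ f) +ₚ h *ₚ (f +ₚ g *ₚ r)
      ∎)
    where
    open ≋-Reasoning
    g : Pol
    g = X^ 1 +ₚ h
    expand : ∀ a x h f r →
             a +ₚ (x +ₚ h) *ₚ (f +ₚ h *ₚ r) ≋ (a +ₚ x *ₚ f) +ₚ h *ₚ (f +ₚ (x +ₚ h) *ₚ r)
    expand = solve 5 (λ a x h f r → a :+ (x :+ h) :* (f :+ h :* r)
                                 := (a :+ x :* f) :+ h :* (f :+ (x :+ h) :* r)) ≋-refl

  f∣f∘[X+fq] : ∀ f q → Σ Pol λ b → f ∘ₚ (X^ 1 +ₚ f *ₚ q) ≋ f *ₚ b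
  f∣f∘[X+fq] f q with ∘ₚ-translate f (f *ₚ q)
  ... | r , f∘g≋f+fqr = (1# ∷ []) +ₚ q *ₚ r , (begin
    f ∘ₚ (X^ 1 +ₚ f *ₚ q)        ≈⟨ f∘g≋f+fqr ⟩
    f +ₚ (f *ₚ q) *ₚ r           ≈⟨ factor f q r ⟩
    f *ₚ ((1# ∷ []) +ₚ q *ₚ r)   ∎)
    where
    open ≋-Reasoning
    factor : ∀ f q r → f +ₚ (f *ₚ q) *ₚ r ≋ f *ₚ ((1# ∷ []) +ₚ q *ₚ r)
    factor = solve 3 (λ f q r → f :+ (f :* q) :* r := f :* (con 1 :+ q :* r)) ≋-refl

-- With this zero test, Degree.HasDegree unfolds to Poly.HasDegree.
domainZeroTest : ∀ {c ℓ} (R : CommutativeRing c ℓ) → IsDomain R →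
                 ZeroTest (CommutativeRing.rawRing R) ℓ
domainZeroTest R D = record
  { IsZero     = _≈ 0#
  ; 0-isZero   = refl
  ; 1-nonZero  = 1≉0
  ; +-isZero   = λ x≈0 y≈0 → trans (+-cong x≈0 y≈0) (+-identityʳ 0#)
  ; +-nonZeroˡ = λ {x} x≉0 y≈0 x+y≈0 →
      x≉0 (trans (sym (trans (+-congˡ y≈0) (+-identityʳ x))) x+y≈0)
  ; +-nonZeroʳ = λ {_} {y} x≈0 y≉0 x+y≈0 →
      y≉0 (trans (sym (trans (+-congʳ x≈0) (+-identityˡ y))) x+y≈0)
  ; *-isZeroˡ  = λ y x≈0 → trans (*-congʳ x≈0) (zeroˡ y)
  ; *-isZeroʳ  = λ x y≈0 → trans (*-congˡ y≈0) (zeroʳ x)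
  ; *-nonZero  = noZeroDiv _ _
  ; ≈-nonZeroʳ = λ x≈y x≉0 y≈0 → x≉0 (trans x≈y y≈0)
  ; ≈-nonZeroˡ = λ x≈y y≉0 x≈0 → y≉0 (trans (sym x≈y) x≈0)
  }
  where open CommutativeRing R; open IsDomain D

module FractionField {c ℓ} (R : CommutativeRing c ℓ) (D : IsDomain R) where
  open CommutativeRing R
  open IsDomain D
  open Frac R D
  open RawRing fracRawRing using ()
    renaming (_≈_ to _≈F_; _+_ to _+F_; _*_ to _*F_)
  module Pᴿ = Poly rawRing
  module Pᶠ = Poly fracRawRing
  module Z₀ = ZeroTest (domainZeroTest R D)
  open CommSemiringSolver commutativeSemiring
  open SetoidReasoning setoid

  num den : FCarrier → Carrier
  num = proj₁ ∘ proj₁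
  den = proj₂ ∘ proj₁

  den≉0 : ∀ X → ¬ den X ≈ 0#
  den≉0 = proj₂

  fracZeroTest : ZeroTest fracRawRing ℓ
  fracZeroTest = record
    { IsZero     = λ X → num X ≈ 0#
    ; 0-isZero   = refl
    ; 1-nonZero  = 1≉0
    ; +-isZero   = λ {X} {Y} zX zY →
        Z₀.+-isZero (Z₀.*-isZeroˡ (den Y) zX) (Z₀.*-isZeroˡ (den X) zY)
    ; +-nonZeroˡ = λ {X} {Y} nX zY →
        Z₀.+-nonZeroˡ (Z₀.*-nonZero nX (den≉0 Y)) (Z₀.*-isZeroˡ (den X) zY)
    ; +-nonZeroʳ = λ {X} {Y} zX nY →
        Z₀.+-nonZeroʳ (Z₀.*-isZeroˡ (den Y) zX) (Z₀.*-nonZero nY (den≉0 X))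
    ; *-isZeroˡ  = λ Y zX → Z₀.*-isZeroˡ (num Y) zX
    ; *-isZeroʳ  = λ X zY → Z₀.*-isZeroʳ (num X) zY
    ; *-nonZero  = Z₀.*-nonZero
    ; ≈-nonZeroʳ = λ {X} {Y} X≈Y nX zY →
        Z₀.≈-nonZeroʳ X≈Y (Z₀.*-nonZero nX (den≉0 Y)) (Z₀.*-isZeroˡ (den X) zY)
    ; ≈-nonZeroˡ = λ {X} {Y} X≈Y nY zX →
        Z₀.≈-nonZeroˡ X≈Y (Z₀.*-nonZero nY (den≉0 X)) (Z₀.*-isZeroˡ (den Y) zX)
    }

  -- A record, so that X and x can be recovered from X ≈ι x by unification.
  infix 4 _≈ι_
  record _≈ι_ (X : FCarrier) (x : Carrier) : Set ℓ where
    constructor mk≈ι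
    field numerator-≈ : num X ≈ x * den X

  ι-≈ι : ∀ x → ι x ≈ι x
  ι-≈ι x = mk≈ι (sym (*-identityʳ x))

  +-≈ι : ∀ {X Y x y} → X ≈ι x → Y ≈ι y → X +F Y ≈ι x + y
  +-≈ι {X} {Y} {x} {y} (mk≈ι X≈x) (mk≈ι Y≈y) = mk≈ι (begin
    num X * den Y + num Y * den X             ≈⟨ +-cong (*-congʳ X≈x) (*-congʳ Y≈y) ⟩
    (x * den X) * den Y + (y * den Y) * den X ≈⟨ solve 4 (λ x y u v → (x :* u) :* v :+ (y :* v) :* u
                                                   := (x :+ y) :* (u :* v)) refl x y (den X) (den Y) ⟩
    (x + y) * (den X * den Y)                 ∎)

  *-≈ι : ∀ {X Y x y} → X ≈ι x → Y ≈ι y → X *F Y ≈ι x * y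
  *-≈ι {X} {Y} {x} {y} (mk≈ι X≈x) (mk≈ι Y≈y) = mk≈ι (begin
    num X * num Y             ≈⟨ *-cong X≈x Y≈y ⟩
    (x * den X) * (y * den Y) ≈⟨ solve 4 (λ x y u v → (x :* u) :* (y :* v) := (x :* y) :* (u :* v))
                                   refl x y (den X) (den Y) ⟩
    (x * y) * (den X * den Y) ∎)

  ≈ι-≈F : ∀ {X Y x y} → X ≈ι x → Y ≈ι y → x ≈ y → X ≈F Y
  ≈ι-≈F {X} {Y} {x} {y} (mk≈ι X≈x) (mk≈ι Y≈y) x≈y = begin
    num X * den Y       ≈⟨ *-congʳ X≈x ⟩
    (x * den X) * den Y ≈⟨ *-congʳ (*-congʳ x≈y) ⟩
    (y * den X) * den Y ≈⟨ solve 3 (λ y u v → (y :* u) :* v := (y :* v) :* u)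
                             refl y (den X) (den Y) ⟩
    (y * den Y) * den X ≈⟨ *-congʳ Y≈y ⟨
    num Y * den X       ∎

  infix 4 _≈ιₚ_
  _≈ιₚ_ : Pᶠ.Pol → Pᴿ.Pol → Set (c ⊔ ℓ)
  _≈ιₚ_ = Pointwise _≈ι_

  +ₚ-≈ι : ∀ {P Q p q} → P ≈ιₚ p → Q ≈ιₚ q → P Pᶠ.+ₚ Q ≈ιₚ p Pᴿ.+ₚ q
  +ₚ-≈ι []             Q≈q            = Q≈q
  +ₚ-≈ι (X≈x ∷ P≈p)    []             = X≈x ∷ P≈p
  +ₚ-≈ι (X≈x ∷ P≈p)    (Y≈y ∷ Q≈q)    = +-≈ι X≈x Y≈y ∷ +ₚ-≈ι P≈p Q≈q

  scale-≈ι : ∀ {X x Q q} → X ≈ι x → Q ≈ιₚ q → Pᶠ.scale X Q ≈ιₚ Pᴿ.scale x q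
  scale-≈ι X≈x []          = []
  scale-≈ι X≈x (Y≈y ∷ Q≈q) = *-≈ι X≈x Y≈y ∷ scale-≈ι X≈x Q≈q

  *ₚ-≈ι : ∀ {P Q p q} → P ≈ιₚ p → Q ≈ιₚ q → P Pᶠ.*ₚ Q ≈ιₚ p Pᴿ.*ₚ q
  *ₚ-≈ι []          Q≈q = []
  *ₚ-≈ι (X≈x ∷ P≈p) Q≈q = +ₚ-≈ι (scale-≈ι X≈x Q≈q) (ι-≈ι 0# ∷ *ₚ-≈ι P≈p Q≈q)

  map-ι-≈ι : ∀ p → map ι p ≈ιₚ p
  map-ι-≈ι []      = []
  map-ι-≈ι (x ∷ p) = ι-≈ι x ∷ map-ι-≈ι p

  coeff-≈ι : ∀ {P p} → P ≈ιₚ p → ∀ n → Pᶠ.coeff P n ≈ι Pᴿ.coeff p n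
  coeff-≈ι []          n       = ι-≈ι 0#
  coeff-≈ι (X≈x ∷ P≈p) zero    = X≈x
  coeff-≈ι (X≈x ∷ P≈p) (suc n) = coeff-≈ι P≈p n

  map-ι-*ₚ : ∀ r p q → r Pᴿ.≈ₚ p Pᴿ.*ₚ q → map ι r Pᶠ.≈ₚ map ι p Pᶠ.*ₚ map ι q
  map-ι-*ₚ r p q r≈pq n =
    ≈ι-≈F (coeff-≈ι (map-ι-≈ι r) n)
          (coeff-≈ι (*ₚ-≈ι (map-ι-≈ι p) (map-ι-≈ι q)) n)
          (r≈pq n)

  coeff-map-ι : ∀ p n → Pᶠ.coeff (map ι p) n ≡ ι (Pᴿ.coeff p n)
  coeff-map-ι []      n       = ≡.refl
  coeff-map-ι (x ∷ p) zero    = ≡.refl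
  coeff-map-ι (x ∷ p) (suc n) = coeff-map-ι p n

  map-ι-hasDegree : ∀ p {d} → Degree.HasDegree (domainZeroTest R D) p d →
                    Degree.HasDegree fracZeroTest (map ι p) d
  map-ι-hasDegree p {d} (nz , below) =
    (λ z → nz (≡.subst (λ X → num X ≈ 0#) (coeff-map-ι p d) z)) ,
    (λ n d<n → ≡.subst (λ X → num X ≈ 0#) (≡.sym (coeff-map-ι p n)) (below n d<n))

module DomainPolynomials {c ℓ} (R : CommutativeRing c ℓ) (D : IsDomain R) where
  open CommutativeRing R using (rawRing; 0#; 1#)
  open IsDomain D using (1≉0)
  open Poly rawRing using (_+ₚ_; _*ₚ_)
  open PolynomialSemiring R using (X^)
  open Degree (domainZeroTest R D)

  X^-hasDegree : ∀ e → HasDegree (X^ e) e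
  X^-hasDegree zero    = 1≉0 , const-degreeBelow 1#
  X^-hasDegree (suc e) = hasDegree-∷⁺ 0# (X^-hasDegree e)

  X+f*X^e-hasDegree : ∀ f {d} e → HasDegree f (suc (suc d)) →
                      HasDegree (X^ 1 +ₚ f *ₚ X^ e) (suc (suc d) ℕ.+ e)
  X+f*X^e-hasDegree f e degf =
    +ₚ-hasDegreeʳ (X^ 1) (f *ₚ X^ e)
      (degreeBelow-mono (X^ 1) (s≤s (s≤s z≤n)) (proj₂ (X^-hasDegree 1)))
      (*ₚ-hasDegree f (X^ e) degf (X^-hasDegree e))

lemma2p1 : ∀ {c ℓ} (R : CommutativeRing c ℓ) (D : IsDomain R)
             (f : Poly.Pol (CommutativeRing.rawRing R)) (d : ℕ) →
             2 ≤ d → Poly.HasDegree (CommutativeRing.rawRing R) f d →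
             ∀ (k : ℕ) → d ≤ k → ¬ WeaklySuperirreducible R D k f
lemma2p1 R D f (suc (suc d)) (s≤s (s≤s z≤n)) degf (suc (suc k)) (s≤s (s≤s d≤k)) superirreducible =
  Fᶻ.properFactor⇒¬Irreducible (map ι (f ∘ₚ g)) (map ι f) (map ι b)
    (map-ι-hasDegree (f ∘ₚ g) (Rᶻ.∘ₚ-hasDegree f g degf degg))
    (map-ι-hasDegree f degf)
    (ℕ.m<m*n (suc (suc d)) (suc (suc k)) (s≤s (s≤s z≤n)))
    (map-ι-*ₚ (f ∘ₚ g) f b (coeff-≈ f∘g≋fb))
    (superirreducible g degg)
  where
  open CommutativeRing R using (rawRing)
  open Poly rawRing using (Pol; _+ₚ_; _*ₚ_; _∘ₚ_)
  open PolynomialSemiring R using (_≋_; X^; f∣f∘[X+fq]; coeff-≈)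
  open FractionField R D using (map-ι-hasDegree; map-ι-*ₚ)
  open Frac R D using (ι)
  open DomainPolynomials R D using (X+f*X^e-hasDegree)
  module Rᶻ = Degree (domainZeroTest R D)
  module Fᶻ = Degree (FractionField.fracZeroTest R D)

  g : Pol
  g = X^ 1 +ₚ f *ₚ X^ (k ℕ.∸ d)

  degg : Rᶻ.HasDegree g (suc (suc k))
  degg = ≡.subst (Rᶻ.HasDegree g) (≡.cong (suc ∘ suc) (ℕ.m+[n∸m]≡n d≤k))
                 (X+f*X^e-hasDegree f (k ℕ.∸ d) degf)

  b : Pol
  b = proj₁ (f∣f∘[X+fq] f (X^ (k ℕ.∸ d)))

  f∘g≋fb : f ∘ₚ g ≋ f *ₚ b
  f∘g≋fb = proj₂ (f∣f∘[X+fq] f (X^ (k ℕ.∸ d)))
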